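{- Let $k\in\mathbb{N}$ and let $\mathsf{D}[k]$ be a DP-core level equipped with a witness action $\rho$. Let $(b,S)$ be a well-formed state and let $f:b\to[k+1]$ be injective. If $(b',S')=(f(b),\rho(f,S))$, then $\mathrm{CAN}(b',S')=\mathrm{CAN}(b,S)$.
   Context: $\mathsf{D}[k]$ has a decidable set $\mathcal{W}_k\subseteq\{0,1\}^*$ of witnesses, a final predicate, and transitions $\mathtt{IntroVertex}_u,\mathtt{ForgetVertex}_u,\mathtt{IntroEdge}_{u,v}:\mathcal{W}_k\to$ finite subsets and $\mathtt{Join}:\mathcal{W}_k^2\to$ finite subsets. Each witness $w$ has a label set $\mathrm{Lbl}_k(w)\subseteq[k+1]$; $\mathrm{Lbl}_k(S)=\bigcup_{w\in S}\mathrm{Lbl}_k(w)$. A state $(b,S)$ ($b\subseteq[k+1]$, $S\subseteq\mathcal{W}_k$ finite) is well-formed if $\mathrm{Lbl}_k(S)\subseteq b$. $\mathcal{F}_k$ is the set of injective $f:b\to[k+1]$ with $b\subseteq[k+1]$; $f^{ -1}$ is the inverse on the image; $f\circ g$ the partial composition with domain $\{u\in\mathrm{dom}(g):g(u)\in\mathrm{dom}(f)\}$. A witness action is a partial map $\rho(f,w)\in\mathcal{W}_k$ defined exactly when $\mathrm{Lbl}_k(w)\subseteq\mathrm{dom}(f)$, extended pointwise to finite sets, such that whenever defined: $\mathtt{Final}(\rho(f,w))=\mathtt{Final}(w)$; $\mathrm{Lbl}_k(\rho(f,w))=f(\mathrm{Lbl}_k(w))$; $\rho(f^{ -1},\rho(f,w))=w$;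 $\rho(f\circ f',w)=\rho(f,\rho(f',w))$; $\rho(f',w)=\rho(f,w)$ whenever $f'$ extends $f$; and $\rho$ commutes with the transitions ($\rho(f,\mathtt{IntroVertex}_u(w))=\mathtt{IntroVertex}_{f(u)}(\rho(f,w))$, likewise for ForgetVertex, $\rho(f,\mathtt{IntroEdge}_{u,v}(w))=\mathtt{IntroEdge}_{f(u),f(v)}(\rho(f,w))$, $\rho(f,\mathtt{Join}(w,w'))=\mathtt{Join}(\rho(f,w),\rho(f,w'))$). Canonization: fix a total order on $\mathcal{W}_k$. For a finite subset $X$ of an ordered set, $\mathrm{vec}(X)$ is its increasing enumeration; sequences are compared lexicographically (a proper prefix is smaller), and pairs $(b,S)$ by the lexicographic order of $(\mathrm{vec}(b),\mathrm{vec}(S))$. For well-formed $(b,S)$: $\mathrm{CAN}(b,S)=\min\{(h(b),\rho(h,S)):h\in\mathcal{F}_k,\ \mathrm{dom}(h)=b\}$. -}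

module Defs where

open import Level using (0ℓ)
open import Data.Bool using (Bool; T)
open import Data.List using (List)
open import Data.List.Membership.Propositional using (_∈_)
open import Data.List.Relation.Unary.Linked using (Linked)
open import Data.List.Relation.Binary.Lex.Core using (Lex-<; Lex-≤)
open import Data.Maybe using (Maybe; just)
open import Data.Nat using (ℕ; suc)
open import Data.Fin using (Fin) renaming (_<_ to _<F_)
open import Data.Fin.Subset using (Subset) renaming (_∈_ to _∈ₛ_)
open import Data.Product using (Σ; _×_; ∃)
open import Data.Sum using (_⊎_)
open import Function.Bundles using (_⇔_)
open import Relation.Binary.PropositionalEquality using (_≡_)
open import Relation.Binary.Core using (Rel)
open import Relation.Binary.Structures using (IsStrictTotalOrder)

-- [k+1] is modelled as Fin (suc k); subsets of [k+1] as Data.Fin.Subset.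

-- Injective partial maps f : b → [n] with b ⊆ [n]  (the set F_k for n = k+1).
-- dom f = { u | app f u ≡ just _ }.
record PInj (n : ℕ) : Set where
  field
    app  : Fin n → Maybe (Fin n)
    .inj : ∀ {u v x} → app u ≡ just x → app v ≡ just x → u ≡ v
open PInj public

_∈dom_ : ∀ {n} → Fin n → PInj n → Set
u ∈dom f = ∃ λ x → app f u ≡ just x

_⊆dom_ : ∀ {n} → Subset n → PInj n → Set
L ⊆dom f = ∀ {u} → u ∈ₛ L → u ∈dom f

DomIs : ∀ {n} → PInj n → Subset n → Set
DomIs f b = ∀ u → (u ∈ₛ b) ⇔ (u ∈dom f)

_∈Img[_]_ : ∀ {n} → Fin n → PInj n → Subset n → Set
x ∈Img[ f ] L = ∃ λ u → u ∈ₛ L × app f u ≡ just x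

IsInv : ∀ {n} → PInj n → PInj n → Set
IsInv g f = ∀ x u → (app g x ≡ just u) ⇔ (app f u ≡ just x)

IsComp : ∀ {n} → PInj n → PInj n → PInj n → Set
IsComp h f g = ∀ u y → (app h u ≡ just y) ⇔ (∃ λ x → app g u ≡ just x × app f x ≡ just y)

Extends : ∀ {n} → PInj n → PInj n → Set
Extends f' f = ∀ u x → app f u ≡ just x → app f' u ≡ just x

-- Witnesses: a decidable subset W_k of {0,1}*.

Wit : (List Bool → Bool) → Set
Wit isW = Σ (List Bool) (λ w → T (isW w))

-- A DP-core level D[k].  Finite subsets of W_k are represented by lists
-- (read as sets, i.e. via membership).
record DPCore (k : ℕ) : Set₁ where
  field
    isW          : List Bool → Bool
    Final        : Wit isW → Bool
    Lbl          : Wit isW → Subset (suc k)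
    IntroVertex  : Fin (suc k) → Wit isW → List (Wit isW)
    ForgetVertex : Fin (suc k) → Wit isW → List (Wit isW)
    IntroEdge    : Fin (suc k) → Fin (suc k) → Wit isW → List (Wit isW)
    Join         : Wit isW → Wit isW → List (Wit isW)
open DPCore public

W : ∀ {k} → DPCore k → Set
W D = Wit (isW D)

-- Type of a partial action: ρ(f,w) is defined exactly when Lbl(w) ⊆ dom(f).
ActionFun : ∀ {k} → DPCore k → Set
ActionFun {k} D = (f : PInj (suc k)) (w : W D) → .(Lbl D w ⊆dom f) → W D

DefOn : ∀ {k} (D : DPCore k) → PInj (suc k) → List (W D) → Set
DefOn D f T = ∀ {w} → w ∈ T → Lbl D w ⊆dom f

ImgSet : ∀ {k} (D : DPCore k) → ActionFun D → PInj (suc k) → List (W D) → W D → Set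
ImgSet D ρ f T z = ∃ λ w → w ∈ T × Σ (Lbl D w ⊆dom f) (λ p → z ≡ ρ f w p)

record WitnessAction {k : ℕ} (D : DPCore k) : Set₁ where
  field
    ρ : ActionFun D
    final : ∀ f w .(p : Lbl D w ⊆dom f) → Final D (ρ f w p) ≡ Final D w
    lbl   : ∀ f w .(p : Lbl D w ⊆dom f) x →
            (x ∈ₛ Lbl D (ρ f w p)) ⇔ (x ∈Img[ f ] Lbl D w)
    inv   : ∀ f g → IsInv g f → ∀ w .(p : Lbl D w ⊆dom f)
              .(q : Lbl D (ρ f w p) ⊆dom g) → ρ g (ρ f w p) q ≡ w
    comp  : ∀ f f' h → IsComp h f f' → ∀ w .(p : Lbl D w ⊆dom h)
              .(q : Lbl D w ⊆dom f') .(r : Lbl D (ρ f' w q) ⊆dom f) →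
              ρ h w p ≡ ρ f (ρ f' w q) r
    ext   : ∀ f f' → Extends f' f → ∀ w .(p : Lbl D w ⊆dom f')
              .(q : Lbl D w ⊆dom f) → ρ f' w p ≡ ρ f w q
    introV  : ∀ f u x → app f u ≡ just x → ∀ w .(p : Lbl D w ⊆dom f) →
              DefOn D f (IntroVertex D u w) →
              ∀ z → ImgSet D ρ f (IntroVertex D u w) z ⇔ (z ∈ IntroVertex D x (ρ f w p))
    forgetV : ∀ f u x → app f u ≡ just x → ∀ w .(p : Lbl D w ⊆dom f) →
              DefOn D f (ForgetVertex D u w) →
              ∀ z → ImgSet D ρ f (ForgetVertex D u w) z ⇔ (z ∈ ForgetVertex D x (ρ f w p))
    introE  : ∀ f u v x y → app f u ≡ just x → app f v ≡ just y →
              ∀ w .(p : Lbl D w ⊆dom f) →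
              DefOn D f (IntroEdge D u v w) →
              ∀ z → ImgSet D ρ f (IntroEdge D u v w) z ⇔ (z ∈ IntroEdge D x y (ρ f w p))
    join    : ∀ f w w' .(p : Lbl D w ⊆dom f) .(p' : Lbl D w' ⊆dom f) →
              DefOn D f (Join D w w') →
              ∀ z → ImgSet D ρ f (Join D w w') z ⇔ (z ∈ Join D (ρ f w p) (ρ f w' p'))
open WitnessAction public

WellFormed : ∀ {k} (D : DPCore k) → Subset (suc k) → List (W D) → Set
WellFormed D b S = ∀ {w} → w ∈ S → ∀ {u} → u ∈ₛ Lbl D w → u ∈ₛ b

-- xs = vec(P): the increasing enumeration of the (finite) set P
IsVec : {A : Set} → Rel A 0ℓ → (A → Set) → List A → Set
IsVec {A} _<_ P xs = Linked _<_ xs × (∀ a → (a ∈ xs) ⇔ P a)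

-- Non-strict lexicographic order on pairs (vec(b), vec(S));
-- sequences compared lexicographically, a proper prefix being smaller.
PairLe : ∀ {k} (D : DPCore k) → Rel (W D) 0ℓ →
         (List (Fin (suc k)) × List (W D)) → (List (Fin (suc k)) × List (W D)) → Set
PairLe D _<W_ (a₁ Data.Product., a₂) (b₁ Data.Product., b₂) =
  Lex-< _≡_ _<F_ a₁ b₁ ⊎ (a₁ ≡ b₁ × Lex-≤ _≡_ _<W_ a₂ b₂)

Attained : ∀ {k} (D : DPCore k) → WitnessAction D → Rel (W D) 0ℓ →
           Subset (suc k) → List (W D) → (List (Fin (suc k)) × List (W D)) → Set
Attained {k} D A _<W_ b S (c₁ Data.Product., c₂) =
  Σ (PInj (suc k)) λ h → DomIs h b
    × IsVec _<F_ (λ x → x ∈Img[ h ] b) c₁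
    × IsVec _<W_ (ImgSet D (ρ A) h S) c₂

IsCAN : ∀ {k} (D : DPCore k) → WitnessAction D → Rel (W D) 0ℓ →
        Subset (suc k) → List (W D) → (List (Fin (suc k)) × List (W D)) → Set
IsCAN D A _<W_ b S c =
  Attained D A _<W_ b S c × (∀ d → Attained D A _<W_ b S d → PairLe D _<W_ c d)

{-# OPTIONS --safe #-}

-- Every partial injection g with domain b' = f(b) yields h = g ∘ f with domain b, and
-- every h with domain b arises this way from g = h ∘ f⁻¹.  Whenever h = g ∘ f we have
-- h(b) = g(b') and, as ρ respects composition, ρ(h,S) = ρ(g,ρ(f,S)) = ρ(g,S').  So the
-- two states attain exactly the same candidate pairs, and hence have the same minimum.

module Submission where

open import Defs
open import Level using (0ℓ)
open import Data.List using (List)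
open import Data.List.Membership.Propositional using (_∈_)
open import Data.Maybe using (Maybe; just; nothing; _>>=_)
open import Data.Maybe.Properties using (just-injective; ≡-dec)
open import Data.Nat using (ℕ; suc)
open import Data.Fin using (Fin; _≟_) renaming (_<_ to _<F_)
open import Data.Fin.Properties using (any?)
open import Data.Fin.Subset using (Subset) renaming (_∈_ to _∈ₛ_)
open import Data.Product using (_×_; _,_; ∃)
open import Data.Product.Function.NonDependent.Propositional using (_×-⇔_)
open import Function using (_∘′_)
open import Function.Bundles using (_⇔_; mk⇔; Equivalence)
open import Function.Properties.Equivalence using () renaming (sym to ⇔-sym; trans to ⇔-trans)
open import Relation.Binary.PropositionalEquality using (_≡_; refl; sym; trans; cong; subst)
open import Relation.Binary.Core using (Rel)
open import Relation.Binary.Structures using (IsStrictTotalOrder)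
open import Relation.Nullary using (yes; no; contradiction)
open import Relation.Nullary.Decidable using (recompute)

open Equivalence using (to; from)

private
  variable
    n : ℕ
    b b' : Subset n

app-injective : (f : PInj n) {u v x : Fin n} → app f u ≡ just x → app f v ≡ just x → u ≡ v
app-injective record { inj = inj } {u} {v} p q = recompute (u ≟ v) (inj p q)

>>=-just : ∀ {A B : Set} (m : Maybe A) {k : A → Maybe B} {y : B} →
           (m >>= k) ≡ just y ⇔ (∃ λ x → m ≡ just x × k x ≡ just y)
>>=-just nothing  = mk⇔ (λ ()) (λ { (_ , () , _) })
>>=-just (just x) = mk⇔ (λ e → x , refl , e) (λ { (_ , refl , e) → e })

>>=-injective : (g f : PInj n) {u v y : Fin n} →
                (app f u >>= app g) ≡ just y → (app f v >>= app g) ≡ just y → u ≡ v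
>>=-injective g f {u} {v} p q with to (>>=-just (app f u)) p | to (>>=-just (app f v)) q
... | x , fu , gx | x' , fv , gx' rewrite app-injective g gx gx' = app-injective f fu fv

infixr 9 _∘ₚ_
infix 10 _⁻¹ₚ

_∘ₚ_ : PInj n → PInj n → PInj n
g ∘ₚ f = record
  { app = λ u → app f u >>= app g
  ; inj = >>=-injective g f
  }

∘ₚ-isComp : (g f : PInj n) → IsComp (g ∘ₚ f) g f
∘ₚ-isComp g f u _ = >>=-just (app f u)

preimage : PInj n → Fin n → Maybe (Fin n)
preimage f x with any? (λ u → ≡-dec _≟_ (app f u) (just x))
... | yes (u , _) = just u
... | no _        = nothing

preimage-isInv : (f : PInj n) → ∀ x u → preimage f x ≡ just u ⇔ app f u ≡ just x
preimage-isInv f x u with any? (λ u → ≡-dec _≟_ (app f u) (just x))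
... | yes (u' , fu') = mk⇔ (λ { refl → fu' }) (λ fu → cong just (app-injective f fu' fu))
... | no ∄u          = mk⇔ (λ ()) (λ fu → contradiction (u , fu) ∄u)

_⁻¹ₚ : PInj n → PInj n
f ⁻¹ₚ = record
  { app = preimage f
  ; inj = λ p q → just-injective (trans (sym (to (preimage-isInv f _ _) p))
                                        (to (preimage-isInv f _ _) q))
  }

isInv-cancelʳ : (f' f g h : PInj n) → IsInv f' f → IsComp g h f' →
                (∀ {u} → u ∈dom h → u ∈dom f) → IsComp h g f
isInv-cancelʳ f' f g h f'≡f⁻¹ g≡h∘f' domh⊆domf u y = mk⇔ ⇒comp comp⇒
  where
  ⇒comp : app h u ≡ just y → ∃ λ x → app f u ≡ just x × app g x ≡ just y
  ⇒comp hu with domh⊆domf (y , hu)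
  ... | x , fu = x , fu , from (g≡h∘f' x y) (u , from (f'≡f⁻¹ x u) fu , hu)
  comp⇒ : (∃ λ x → app f u ≡ just x × app g x ≡ just y) → app h u ≡ just y
  comp⇒ (x , fu , gx) with to (g≡h∘f' x y) gx
  ... | u' , f'x , hu' = subst (λ v → app h v ≡ just y)
                               (app-injective f (to (f'≡f⁻¹ x u') f'x) fu) hu'

_≈Img[_]_ : Subset n → PInj n → Subset n → Set
b' ≈Img[ f ] b = ∀ x → (x ∈ₛ b') ⇔ (x ∈Img[ f ] b)

isComp-DomIs : (h g f : PInj n) → IsComp h g f →
               DomIs f b → b' ≈Img[ f ] b → DomIs g b' → DomIs h b
isComp-DomIs {b = b} h g f h≡g∘f domf b'≈fb domg u = mk⇔ ⇒dom dom⇒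
  where
  ⇒dom : u ∈ₛ b → u ∈dom h
  ⇒dom ub with to (domf u) ub
  ... | x , fu with to (domg x) (from (b'≈fb x) (u , ub , fu))
  ... | y , gx = y , from (h≡g∘f u y) (x , fu , gx)
  dom⇒ : u ∈dom h → u ∈ₛ b
  dom⇒ (y , hu) with to (h≡g∘f u y) hu
  ... | x , fu , _ = from (domf u) (x , fu)

isInv-DomIs : (g h f' f : PInj n) → IsComp g h f' → IsInv f' f →
              b' ≈Img[ f ] b → DomIs h b → DomIs g b'
isInv-DomIs {b' = b'} {b = b} g h f' f g≡h∘f' f'≡f⁻¹ b'≈fb domh x = mk⇔ ⇒dom dom⇒
  where
  ⇒dom : x ∈ₛ b' → x ∈dom g
  ⇒dom xb' with to (b'≈fb x) xb'
  ... | u , ub , fu with to (domh u) ub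
  ... | y , hu = y , from (g≡h∘f' x y) (u , from (f'≡f⁻¹ x u) fu , hu)
  dom⇒ : x ∈dom g → x ∈ₛ b'
  dom⇒ (y , gx) with to (g≡h∘f' x y) gx
  ... | u , f'x , hu = from (b'≈fb x) (u , from (domh u) (y , hu) , to (f'≡f⁻¹ x u) f'x)

isComp-Img : (h g f : PInj n) → IsComp h g f → b' ≈Img[ f ] b →
             ∀ x → x ∈Img[ h ] b ⇔ x ∈Img[ g ] b'
isComp-Img {b' = b'} {b = b} h g f h≡g∘f b'≈fb x = mk⇔ ⇒img img⇒
  where
  ⇒img : x ∈Img[ h ] b → x ∈Img[ g ] b'
  ⇒img (u , ub , hu) with to (h≡g∘f u x) hu
  ... | y , fu , gy = y , from (b'≈fb y) (u , ub , fu) , gy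
  img⇒ : x ∈Img[ g ] b' → x ∈Img[ h ] b
  img⇒ (y , yb' , gy) with to (b'≈fb y) yb'
  ... | u , ub , fu = u , ub , from (h≡g∘f u x) (y , fu , gy)

IsVec-cong : ∀ {B : Set} {_<_ : Rel B 0ℓ} {P Q : B → Set} {xs} →
             (∀ a → P a ⇔ Q a) → IsVec _<_ P xs ⇔ IsVec _<_ Q xs
IsVec-cong P⇔Q = mk⇔ (λ { (sorted , mem) → sorted , λ a → ⇔-trans (mem a) (P⇔Q a) })
                     (λ { (sorted , mem) → sorted , λ a → ⇔-trans (mem a) (⇔-sym (P⇔Q a)) })

module _ {k : ℕ} {D : DPCore k} (A : WitnessAction D) where

  private
    variable
      S S' : List (W D)

  _≈ρ[_]_ : List (W D) → PInj (suc k) → List (W D) → Set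
  S' ≈ρ[ f ] S = ∀ z → (z ∈ S') ⇔ ImgSet D (ρ A) f S z

  WellFormed⇒DefOn : (h : PInj (suc k)) → WellFormed D b S → DomIs h b → DefOn D h S
  WellFormed⇒DefOn h wf domh w∈S u∈L = to (domh _) (wf w∈S u∈L)

  WellFormed-image : (f : PInj (suc k)) → WellFormed D b S →
                     b' ≈Img[ f ] b → S' ≈ρ[ f ] S → WellFormed D b' S'
  WellFormed-image f wf b'≈fb S'≈fS {w'} w'∈S' {x} x∈L with to (S'≈fS w') w'∈S'
  ... | w , w∈S , p , refl with to (lbl A f w p x) x∈L
  ... | u , u∈L , fu = from (b'≈fb x) (u , wf w∈S u∈L , fu)

  isComp-ImgSet : (h g f : PInj (suc k)) → IsComp h g f →
                  DefOn D f S → DefOn D h S → DefOn D g S' → S' ≈ρ[ f ] S →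
                  ∀ z → ImgSet D (ρ A) h S z ⇔ ImgSet D (ρ A) g S' z
  isComp-ImgSet {S = S} {S' = S'} h g f h≡g∘f f-S h-S g-S' S'≈fS z = mk⇔ ⇒img img⇒
    where
    ⇒img : ImgSet D (ρ A) h S z → ImgSet D (ρ A) g S' z
    ⇒img (w , w∈S , p , z≡) =
      ρ A f w (f-S w∈S) , fw∈S' , g-S' fw∈S' ,
      trans z≡ (comp A g f h h≡g∘f w p (f-S w∈S) (g-S' fw∈S'))
      where
      fw∈S' : ρ A f w (f-S w∈S) ∈ S'
      fw∈S' = from (S'≈fS _) (w , w∈S , f-S w∈S , refl)
    img⇒ : ImgSet D (ρ A) g S' z → ImgSet D (ρ A) h S z
    img⇒ (w' , w'∈S' , r , z≡) with to (S'≈fS w') w'∈S'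
    ... | w , w∈S , q , refl =
      w , w∈S , h-S w∈S , trans z≡ (sym (comp A g f h h≡g∘f w (h-S w∈S) q r))

  module _ (_<W_ : Rel (W D) 0ℓ) where

    AttainedBy : PInj (suc k) → Subset (suc k) → List (W D) →
                 List (Fin (suc k)) × List (W D) → Set
    AttainedBy h b S (c₁ , c₂) =
      IsVec _<F_ (_∈Img[ h ] b) c₁ × IsVec _<W_ (ImgSet D (ρ A) h S) c₂

    IsCAN-cong : (∀ d → Attained D A _<W_ b S d ⇔ Attained D A _<W_ b' S' d) →
                 ∀ c → IsCAN D A _<W_ b S c ⇔ IsCAN D A _<W_ b' S' c
    IsCAN-cong att c =
      mk⇔ (λ { (attained , least) → to (att c) attained , λ d → least d ∘′ from (att d) })
          (λ { (attained , least) → from (att c) attained , λ d → least d ∘′ to (att d) })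

    module _ {b b' : Subset (suc k)} {S S' : List (W D)} {f : PInj (suc k)}
             (wf : WellFormed D b S) (domf : DomIs f b)
             (b'≈fb : b' ≈Img[ f ] b) (S'≈fS : S' ≈ρ[ f ] S) where

      isComp-AttainedBy : (h g : PInj (suc k)) → IsComp h g f → DomIs h b → DomIs g b' →
                          ∀ c → AttainedBy h b S c ⇔ AttainedBy g b' S' c
      isComp-AttainedBy h g h≡g∘f domh domg (c₁ , c₂) =
        IsVec-cong (isComp-Img h g f h≡g∘f b'≈fb)
        ×-⇔ IsVec-cong (isComp-ImgSet h g f h≡g∘f (WellFormed⇒DefOn f wf domf)
                          (WellFormed⇒DefOn h wf domh)
                          (WellFormed⇒DefOn g (WellFormed-image f wf b'≈fb S'≈fS) domg)
                          S'≈fS)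

      Attained-image-⇔ : ∀ c → Attained D A _<W_ b' S' c ⇔ Attained D A _<W_ b S c
      Attained-image-⇔ (c₁ , c₂) = mk⇔ ⇒att att⇒
        where
        ⇒att : Attained D A _<W_ b' S' (c₁ , c₂) → Attained D A _<W_ b S (c₁ , c₂)
        ⇒att (g , domg , attained) =
          g ∘ₚ f , domh ,
          from (isComp-AttainedBy (g ∘ₚ f) g (∘ₚ-isComp g f) domh domg (c₁ , c₂)) attained
          where
          domh : DomIs (g ∘ₚ f) b
          domh = isComp-DomIs (g ∘ₚ f) g f (∘ₚ-isComp g f) domf b'≈fb domg
        att⇒ : Attained D A _<W_ b S (c₁ , c₂) → Attained D A _<W_ b' S' (c₁ , c₂)
        att⇒ (h , domh , attained) =
          h ∘ₚ f ⁻¹ₚ , domg ,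
          to (isComp-AttainedBy h (h ∘ₚ f ⁻¹ₚ) h≡g∘f domh domg (c₁ , c₂)) attained
          where
          domg : DomIs (h ∘ₚ f ⁻¹ₚ) b'
          domg = isInv-DomIs (h ∘ₚ f ⁻¹ₚ) h (f ⁻¹ₚ) f
                             (∘ₚ-isComp h (f ⁻¹ₚ)) (preimage-isInv f) b'≈fb domh
          h≡g∘f : IsComp h (h ∘ₚ f ⁻¹ₚ) f
          h≡g∘f = isInv-cancelʳ (f ⁻¹ₚ) f (h ∘ₚ f ⁻¹ₚ) h
                                (preimage-isInv f) (∘ₚ-isComp h (f ⁻¹ₚ))
                                (λ {u} u∈domh → to (domf u) (from (domh u) u∈domh))

lemma9 : (k : ℕ) (D : DPCore k) (A : WitnessAction D)
         (_<W_ : Rel (W D) 0ℓ) → IsStrictTotalOrder _≡_ _<W_ →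
         (b : Subset (suc k)) (S : List (W D)) → WellFormed D b S →
         (f : PInj (suc k)) → DomIs f b →
         (b' : Subset (suc k)) (S' : List (W D)) →
         (∀ x → (x ∈ₛ b') ⇔ (x ∈Img[ f ] b)) →
         (∀ z → (z ∈ S') ⇔ ImgSet D (ρ A) f S z) →
         ∀ (c : List (Fin (suc k)) × List (W D)) →
         IsCAN D A _<W_ b' S' c ⇔ IsCAN D A _<W_ b S c
lemma9 k D A _<W_ _ b S wf f domf b' S' b'≈fb S'≈fS =
  IsCAN-cong A _<W_ (Attained-image-⇔ A _<W_ wf domf b'≈fb S'≈fS)
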